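{- Let $X$ be a weighted sequence of length $n$ over a finite alphabet $\Sigma$, let $\frac1z$ be a threshold probability, and let $\mathbf{X}$ be a fixed heavy string of $X$. Let $\mathcal{E}$ be the set of extensions of all solid factors of $X$. Then $\mathcal{E}$ is exactly the set of extensions of all maximal solid factors of $X$.
   Context: A weighted sequence $X=x_1\ldots x_n$ over $\Sigma$ assigns to each position $i\in\{1,\ldots,n\}$ and each letter $s\in\Sigma$ a probability $\pi_i(s)\ge 0$, with $\sum_{s\in\Sigma}\pi_i(s)=1$ for each $i$. A string $F$ (possibly empty) is a solid factor of $X$ at position $i$ (i.e. starting at position $i$ and ending at position $j=i+|F|-1\le n$) if $\prod_{k=1}^{|F|}\pi_{i+k-1}(F[k])\ge \frac1z$. A solid factor $F$ at position $i$ is (right-)maximal if no string $Fs$ with $s\in\Sigma$ is a solid factor of $X$ at position $i$. The heavy string $\mathbf{X}$ is obtained by choosing at each position $i$ a letter of maximum probability $\pi_i$ (ties broken arbitrarily, but fixed). If $F$ is a solid factor of $X$ starting at position $i$ and ending at position $j\ge i-1$, the string $F\,\mathbf{X}[j+1..n]$ is called the extension of the solid factor $F$.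
   Formalization: The occurrence probabilities $\pi_i(s)$ of the weighted sequence and the threshold $\frac1z$ take rational values. -}

module Defs where

open import Data.Nat as ℕ using (ℕ; zero; suc)
open import Data.Fin using (Fin)
open import Data.List using (List; []; _∷_; _++_; [_]; drop; length; map; foldr)
open import Data.List.Membership.Propositional using (_∈_)
open import Data.Vec as Vec using (Vec; lookup; toList; allFin)
open import Data.Rational using (ℚ; 0ℚ; 1ℚ; _+_; _*_; _≤_; 1/_; NonZero)
open import Data.Product using (_×_; ∃; ∃-syntax)
open import Relation.Nullary using (¬_)
open import Relation.Binary.PropositionalEquality using (_≡_)

Dist : ℕ → Set
Dist σ = Fin σ → ℚ

-- A weighted sequence X = x_1 … x_n over Σ = Fin σ (positions 0-indexed here).
WSeq : ℕ → ℕ → Set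
WSeq n σ = Vec (Dist σ) n

sumℚ : List ℚ → ℚ
sumℚ = foldr _+_ 0ℚ

IsWeightedSeq : ∀ {n σ} → WSeq n σ → Set
IsWeightedSeq {n} {σ} X =
  (∀ (k : Fin n) (s : Fin σ) → 0ℚ ≤ lookup X k s) ×
  (∀ (k : Fin n) → sumℚ (map (lookup X k) (toList (allFin σ))) ≡ 1ℚ)

-- Probability of a string F read from the start of a list of distributions;
-- (only used when F fits, the length condition is imposed separately).
prob : ∀ {σ} → List (Dist σ) → List (Fin σ) → ℚ
prob _ [] = 1ℚ
prob [] (_ ∷ _) = 0ℚ
prob (p ∷ ps) (s ∷ F) = p s * prob ps F

Solid : ∀ {n σ} → WSeq n σ → (z : ℚ) → .{{_ : NonZero z}} → ℕ → List (Fin σ) → Set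
Solid {n} X z i F =
  (i ℕ.< n) × (i ℕ.+ length F ℕ.≤ n) × (1/ z ≤ prob (drop i (toList X)) F)

MaximalSolid : ∀ {n σ} → WSeq n σ → (z : ℚ) → .{{_ : NonZero z}} → ℕ → List (Fin σ) → Set
MaximalSolid X z i F = Solid X z i F × (∀ s → ¬ Solid X z i (F ++ [ s ]))

IsHeavy : ∀ {n σ} → WSeq n σ → Vec (Fin σ) n → Set
IsHeavy {n} {σ} X H = ∀ (k : Fin n) (s : Fin σ) → lookup X k s ≤ lookup X k (lookup H k)

extension : ∀ {n σ} → Vec (Fin σ) n → ℕ → List (Fin σ) → List (Fin σ)
extension H i F = F ++ drop (i ℕ.+ length F) (toList H)

InExtSolid : ∀ {n σ} → WSeq n σ → (z : ℚ) → .{{_ : NonZero z}} → Vec (Fin σ) n → List (Fin σ) → Set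
InExtSolid X z H E = ∃[ i ] ∃[ F ] (Solid X z i F × E ≡ extension H i F)

InExtMaximal : ∀ {n σ} → WSeq n σ → (z : ℚ) → .{{_ : NonZero z}} → Vec (Fin σ) n → List (Fin σ) → Set
InExtMaximal X z H E = ∃[ i ] ∃[ F ] (MaximalSolid X z i F × E ≡ extension H i F)

module Submission where

-- Every maximal solid factor is solid, so one inclusion is immediate.  For the
-- other, take a solid factor F at position i and extend it greedily with the
-- letters of the heavy string X[i+|F|], X[i+|F|+1], ... for as long as the
-- result stays solid.  Appending a heavy letter does not change the extension,
-- because the extension already continues with exactly that letter.  The
-- process stops at a factor G that is maximal: appending any letter s
-- multiplies the probability by π(s), which is at most the factor π(h) of the
-- heavy letter h that just failed; past the end of X the probability is 0.

open import Defs
open import Data.Nat using (ℕ)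
open import Data.Fin using (Fin)
open import Data.List using (List)
open import Data.Vec using (Vec)
open import Data.Rational using (ℚ; 0ℚ; _<_; NonZero)
open import Data.Product using (_×_)

open import Data.Nat as ℕ using (zero; suc)
import Data.Nat.Properties as ℕ
open import Data.List using ([]; _∷_; _++_; [_]; drop; length)
open import Data.List.Properties using (length-++; length-drop; drop-drop; ++-assoc)
open import Data.List.Relation.Binary.Pointwise using (Pointwise; []; _∷_)
open import Data.Vec as Vec using (toList)
open import Data.Vec.Properties using (length-toList)
open import Data.Rational using (1ℚ; _*_; _≤_; 1/_; nonNegative; positive)
open import Data.Rational.Properties
  using (≤-trans; ≤-reflexive; <-irrefl; <-≤-trans; <⇒≤; _≤?_;
         *-zeroˡ; *-zeroʳ; *-identityˡ; *-identityʳ; *-assoc; *-monoˡ-≤-nonNeg;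
         1/pos⇒pos; positive⁻¹)
open import Data.Product using (Σ; _,_)
open import Relation.Nullary using (¬_; yes; no)
open import Relation.Binary.PropositionalEquality using (_≡_; refl; sym; trans; cong; subst; module ≡-Reasoning)

HeavyAt : ∀ {σ} → Dist σ → Fin σ → Set
HeavyAt p h = ∀ s → p s ≤ p h

heavy-toList : ∀ {n σ} {X : WSeq n σ} {H : Vec (Fin σ) n} →
  IsHeavy X H → Pointwise HeavyAt (toList X) (toList H)
heavy-toList {X = Vec.[]}    {Vec.[]}    heavy = []
heavy-toList {X = _ Vec.∷ _} {_ Vec.∷ _} heavy =
  heavy Data.Fin.zero ∷ heavy-toList (λ k → heavy (Data.Fin.suc k))

pointwise-drop : ∀ {A B : Set} {R : A → B → Set} k {xs ys} →
  Pointwise R xs ys → Pointwise R (drop k xs) (drop k ys)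
pointwise-drop zero    rs       = rs
pointwise-drop (suc k) []       = []
pointwise-drop (suc k) (_ ∷ rs) = pointwise-drop k rs

drop-snoc : ∀ {A B : Set} (F : List B) {b : B} {xs : List A} {x rest} →
  drop (length F) xs ≡ x ∷ rest → drop (length (F ++ [ b ])) xs ≡ rest
drop-snoc F {b} {xs} eq = begin
  drop (length (F ++ [ b ])) xs    ≡⟨ cong (λ k → drop k xs) (length-++ F) ⟩
  drop (length F ℕ.+ 1) xs         ≡⟨ sym (drop-drop (length F) 1 xs) ⟩
  drop 1 (drop (length F) xs)      ≡⟨ cong (drop 1) eq ⟩
  _                                ∎
  where open ≡-Reasoning

prob-++ : ∀ {σ} (ps : List (Dist σ)) (F G : List (Fin σ)) →
  prob ps (F ++ G) ≡ prob ps F * prob (drop (length F) ps) G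
prob-++ ps       []      G = sym (*-identityˡ (prob ps G))
prob-++ []       (_ ∷ _) G = sym (*-zeroˡ (prob [] G))
prob-++ (p ∷ ps) (c ∷ F) G = begin
  p c * prob ps (F ++ G)                          ≡⟨ cong (p c *_) (prob-++ ps F G) ⟩
  p c * (prob ps F * prob (drop (length F) ps) G) ≡⟨ sym (*-assoc (p c) _ _) ⟩
  p c * prob ps F * prob (drop (length F) ps) G   ∎
  where open ≡-Reasoning

prob-overrun : ∀ {σ} (ps : List (Dist σ)) (F : List (Fin σ)) →
  length ps ℕ.< length F → prob ps F ≡ 0ℚ
prob-overrun []       (_ ∷ _) _            = refl
prob-overrun (p ∷ ps) (c ∷ F) (ℕ.s≤s lt) =
  trans (cong (p c *_) (prob-overrun ps F lt)) (*-zeroʳ (p c))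

module Greedy {σ : ℕ} (z : ℚ) .{{_ : NonZero z}} (0<1/z : 0ℚ < 1/ z)
              (ps : List (Dist σ)) where

  Likely : List (Fin σ) → Set
  Likely F = 1/ z ≤ prob ps F

  unlikely-if-zero : ∀ F → prob ps F ≡ 0ℚ → ¬ Likely F
  unlikely-if-zero F is-zero lik = <-irrefl refl (<-≤-trans 0<1/z (subst (1/ z ≤_) is-zero lik))

  likely-fits : ∀ F → Likely F → length F ℕ.≤ length ps
  likely-fits F lik = ℕ.≮⇒≥ λ lt → unlikely-if-zero F (prob-overrun ps F lt) lik

  stuck-at-end : ∀ F → drop (length F) ps ≡ [] → ∀ s → ¬ Likely (F ++ [ s ])
  stuck-at-end F end s = unlikely-if-zero (F ++ [ s ]) (begin
    prob ps (F ++ [ s ])                        ≡⟨ prob-++ ps F [ s ] ⟩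
    prob ps F * prob (drop (length F) ps) [ s ] ≡⟨ cong (λ qs → prob ps F * prob qs [ s ]) end ⟩
    prob ps F * 0ℚ                              ≡⟨ *-zeroʳ (prob ps F) ⟩
    0ℚ                                          ∎)
    where open ≡-Reasoning

  heavy-best : ∀ F {q qs h} → drop (length F) ps ≡ q ∷ qs → HeavyAt q h →
    Likely F → ∀ s → prob ps (F ++ [ s ]) ≤ prob ps (F ++ [ h ])
  heavy-best F {q} {qs} {h} next qh lik s = begin
    prob ps (F ++ [ s ])   ≡⟨ step s ⟩
    prob ps F * (q s * 1ℚ) ≤⟨ *-monoˡ-≤-nonNeg (prob ps F) {{nonNegative 0≤F}} (≤-reflexive (*-identityʳ (q s))) ⟩
    prob ps F * q s        ≤⟨ *-monoˡ-≤-nonNeg (prob ps F) {{nonNegative 0≤F}} (qh s) ⟩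
    prob ps F * q h        ≡⟨ cong (prob ps F *_) (sym (*-identityʳ (q h))) ⟩
    prob ps F * (q h * 1ℚ) ≡⟨ sym (step h) ⟩
    prob ps (F ++ [ h ])   ∎
    where
    open Data.Rational.Properties.≤-Reasoning
    0≤F : 0ℚ ≤ prob ps F
    0≤F = ≤-trans (<⇒≤ 0<1/z) lik
    step : ∀ s → prob ps (F ++ [ s ]) ≡ prob ps F * (q s * 1ℚ)
    step s = trans (prob-++ ps F [ s ]) (cong (λ qs′ → prob ps F * prob qs′ [ s ]) next)

  module _ (hs : List (Fin σ)) where

    MaximalExtension : List (Fin σ) → Set
    MaximalExtension F = Σ (List (Fin σ)) λ G →
      Likely G × (∀ s → ¬ Likely (G ++ [ s ])) ×
      (G ++ drop (length G) hs ≡ F ++ drop (length F) hs)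

    -- Extend F by heavy letters while it stays solid; recursion on the heavy
    -- suffix qs/rest of ps/hs that follows F.
    extend : ∀ F {qs rest} → drop (length F) ps ≡ qs → drop (length F) hs ≡ rest →
      Pointwise HeavyAt qs rest → Likely F → MaximalExtension F
    extend F end _ [] lik = F , lik , stuck-at-end F end , refl
    extend F {rest = h ∷ rest} next nextH (qh ∷ heavy) lik with 1/ z ≤? prob ps (F ++ [ h ])
    ... | no unlikely = F , lik , (λ s liks → unlikely (≤-trans liks (heavy-best F next qh lik s))) , refl
    ... | yes likely with extend (F ++ [ h ]) (drop-snoc F next) (drop-snoc F nextH) heavy likely
    ... | G , likG , maxG , extG = G , likG , maxG , (begin
      G ++ drop (length G) hs                         ≡⟨ extG ⟩
      (F ++ [ h ]) ++ drop (length (F ++ [ h ])) hs   ≡⟨ cong ((F ++ [ h ]) ++_) (drop-snoc F nextH) ⟩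
      (F ++ [ h ]) ++ rest                            ≡⟨ ++-assoc F [ h ] rest ⟩
      F ++ h ∷ rest                                   ≡⟨ cong (F ++_) (sym nextH) ⟩
      F ++ drop (length F) hs                         ∎)
      where open ≡-Reasoning

    maximalExtension : Pointwise HeavyAt ps hs → ∀ F → Likely F → MaximalExtension F
    maximalExtension heavy F =
      extend F refl refl (pointwise-drop (length F) heavy)

solid-from-suffix : ∀ {n σ} (X : WSeq n σ) (z : ℚ) .{{_ : NonZero z}} → 0ℚ < 1/ z →
  ∀ {i F} → i ℕ.< n → 1/ z ≤ prob (drop i (toList X)) F → Solid X z i F
solid-from-suffix {n} X z 0<1/z {i} {F} i<n lik = i<n , fits , lik
  where
  F≤n∸i : length F ℕ.≤ n ℕ.∸ i
  F≤n∸i = subst (length F ℕ.≤_)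
    (trans (length-drop i (toList X)) (cong (ℕ._∸ i) (length-toList X)))
    (Greedy.likely-fits z 0<1/z (drop i (toList X)) F lik)
  fits : i ℕ.+ length F ℕ.≤ n
  fits = subst (i ℕ.+ length F ℕ.≤_) (ℕ.m+[n∸m]≡n (ℕ.<⇒≤ i<n)) (ℕ.+-monoʳ-≤ i F≤n∸i)

extension-suffix : ∀ {n σ} (H : Vec (Fin σ) n) i (F : List (Fin σ)) →
  extension H i F ≡ F ++ drop (length F) (drop i (toList H))
extension-suffix H i F = cong (F ++_) (sym (drop-drop i (length F) (toList H)))

mainTheorem1 : (n σ : ℕ) (X : WSeq n σ) → IsWeightedSeq X →
    (z : ℚ) → .{{_ : NonZero z}} → 0ℚ < z →
    (H : Vec (Fin σ) n) → IsHeavy X H →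
    (E : List (Fin σ)) →
    (InExtSolid X z H E → InExtMaximal X z H E) × (InExtMaximal X z H E → InExtSolid X z H E)
mainTheorem1 n σ X _ z 0<z H heavy E = toMaximal , fromMaximal
  where
  0<1/z : 0ℚ < 1/ z
  0<1/z = positive⁻¹ _ {{1/pos⇒pos z {{positive 0<z}}}}

  fromMaximal : InExtMaximal X z H E → InExtSolid X z H E
  fromMaximal (i , F , (solid , _) , e) = i , F , solid , e

  toMaximal : InExtSolid X z H E → InExtMaximal X z H E
  toMaximal (i , F , (i<n , _ , lik) , e)
    with Greedy.maximalExtension z 0<1/z (drop i (toList X)) (drop i (toList H))
           (pointwise-drop i (heavy-toList heavy)) F lik
  ... | G , likG , maxG , extG =
    i , G , (solid-from-suffix X z 0<1/z {F = G} i<n likG , λ s (_ , _ , lik′) → maxG s lik′) ,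
    trans e (trans (extension-suffix H i F) (trans (sym extG) (sym (extension-suffix H i G))))
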